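{- Let $V$ be a finite set of variables and let $\mathcal{B}$ be a Sperner family of nonempty proper subsets of $V$ with $\bigcup_{B\in\mathcal{B}}B=V$ and $\bigcap_{B\in\mathcal{B}}B=\emptyset$, and let $k$ be an upper bound on the sizes of the members of $\mathcal{B}$. If $E'$ is the arc set of a Hamiltonian cycle in the body graph $D_{\mathcal{B}}$, then $\Phi_{E'}=\bigwedge_{(B,B')\in E'}B\rightarrow(B'\setminus B)$ is a representation of $h_{\mathcal{B}}$ with $|\Phi_{E'}|_*\le k\cdot OPT_*(\mathcal{B})$ for every measure $*\in\{B,BA,TA,C,BC,L\}$.
   Context: A pure Horn clause $B\rightarrow v$, with $\emptyset\neq B\subseteq V$ and $v\in V\setminus B$, is the clause $v\vee\bigvee_{u\in B}\overline{u}$. For $H\subseteq V\setminus B$, $B\rightarrow H$ abbreviates $\bigwedge_{v\in H}B\rightarrow v$. A pure Horn CNF grouped by bodies is written $\Phi=\bigwedge_{i=1}^{r}B_i\rightarrow H_i$ with distinct bodies $B_i$ and nonempty $H_i$. Measures: $|\Phi|_B=r$, $|\Phi|_{BA}=\sum_i|B_i|$, $|\Phi|_{TA}=\sum_i(|B_i|+|H_i|)$, $|\Phi|_C=\sum_i|H_i|$, $|\Phi|_{BC}=\sum_i(|H_i|+1)$, $|\Phi|_L=\sum_i(|B_i|+1)|H_i|$. The key Horn function $h_{\mathcal{B}}$ is represented by $\bigwedge_{B\in\mathcal{B}}B\rightarrow(V\setminus B)$; a representation is any equivalent pure Horn CNF and $OPT_*(\mathcal{B})$ is the minimum of $|\cdot|_*$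 over representations. The body graph $D_{\mathcal{B}}$ is the complete directed graph with node set $\mathcal{B}$ and arc set $\mathcal{B}\times\mathcal{B}$. Sperner means no member of $\mathcal{B}$ is a proper subset of another. -}

module Defs where

open import Data.Nat using (ℕ; zero; suc; _+_; _*_; _≤_)
open import Data.Bool using (Bool)
open import Data.Fin.Subset
  using (Subset; _⊆_; _⊂_; _∩_; _─_; ∁; ⋃; ⋂; ∣_∣; Nonempty; Empty; ⊤; ⊥)
open import Data.List using (List; []; _∷_; map; zip; _++_; [_])
open import Data.Nat.ListAction using (sum)
open import Data.List.Relation.Unary.All using (All)
open import Data.List.Relation.Unary.Unique.Propositional using (Unique)
open import Data.List.Membership.Propositional using (_∈_)
open import Data.Product using (_×_; _,_; proj₁; proj₂)
open import Relation.Nullary using (¬_)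
open import Relation.Binary.PropositionalEquality using (_≡_; _≢_)
open import Function.Bundles using (_⇔_)

-- Variables V = Fin n; subsets of V (and truth assignments) are Subset n.

-- A grouped pure Horn CNF: a list of (body , head) pairs, read as  B → H.
Clause : ℕ → Set
Clause n = Subset n × Subset n

CNF : ℕ → Set
CNF n = List (Clause n)

WellFormedClause : ∀ {n} → Clause n → Set
WellFormedClause (B , H) = Nonempty B × Nonempty H × Empty (B ∩ H)

IsPureHornCNF : ∀ {n} → CNF n → Set
IsPureHornCNF Φ = All WellFormedClause Φ × Unique (map proj₁ Φ)

Sat : ∀ {n} → CNF n → Subset n → Set
Sat Φ x = All (λ c → proj₁ c ⊆ x → proj₂ c ⊆ x) Φ

-- The defining CNF of the key Horn function h_𝓑 :  ⋀_{B ∈ 𝓑} B → (V ∖ B).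
keyCNF : ∀ {n} → List (Subset n) → CNF n
keyCNF 𝓑 = map (λ B → B , ∁ B) 𝓑

IsRepresentation : ∀ {n} → List (Subset n) → CNF n → Set
IsRepresentation {n} 𝓑 Φ =
  IsPureHornCNF Φ × (∀ (x : Subset n) → Sat Φ x ⇔ Sat (keyCNF 𝓑) x)

data Measure : Set where
  mB mBA mTA mC mBC mL : Measure

size : ∀ {n} → Measure → CNF n → ℕ
size mB  Φ = sum (map (λ _ → 1) Φ)
size mBA Φ = sum (map (λ c → ∣ proj₁ c ∣) Φ)
size mTA Φ = sum (map (λ c → ∣ proj₁ c ∣ + ∣ proj₂ c ∣) Φ)
size mC  Φ = sum (map (λ c → ∣ proj₂ c ∣) Φ)
size mBC Φ = sum (map (λ c → ∣ proj₂ c ∣ + 1) Φ)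
size mL  Φ = sum (map (λ c → (∣ proj₁ c ∣ + 1) * ∣ proj₂ c ∣) Φ)

Sperner : ∀ {n} → List (Subset n) → Set
Sperner 𝓑 = ∀ {B B'} → B ∈ 𝓑 → B' ∈ 𝓑 → ¬ (B ⊂ B')

-- Arc set of the directed cycle visiting the list in order and closing up:
-- (c₀,c₁), (c₁,c₂), …, (c_{m-1},c₀).
cycleArcs : ∀ {a} {A : Set a} → List A → List (A × A)
cycleArcs []       = []
cycleArcs (x ∷ xs) = zip (x ∷ xs) (xs ++ [ x ])

arcCNF : ∀ {n} → List (Subset n × Subset n) → CNF n
arcCNF E = map (λ e → proj₁ e , (proj₂ e ─ proj₁ e)) E

-- Every clause of Φ_{E'} has its body B ∈ 𝓑, and its head B' ∖ B is nonempty because 𝓑 is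
-- Sperner. A truth assignment satisfying Φ_{E'} and containing one body contains, going round
-- the cycle, every body, hence ⋃ 𝓑 = V; so Φ_{E'} is equivalent to h_𝓑. Conversely, every
-- representation Ψ has a clause with body exactly B for each B ∈ 𝓑: the assignment B falsifies
-- h_𝓑, so some clause of Ψ has a body D ⊆ B, and D, not being a model of Ψ, must contain a
-- member of 𝓑, which is B by the Sperner property. The clause of Φ_{E'} with body B has at most
-- k head literals, so it costs at most k times that clause of Ψ in each of the six measures.
module Submission where

open import Defs
open import Data.Nat using (ℕ; _*_; _≤_; _<_; _+_; z≤n; NonZero; >-nonZero)
open import Data.Nat.Properties
  using (≤-trans; ≤-reflexive; +-mono-≤; *-monoʳ-≤; *-distribˡ-+; *-assoc; *-comm; m≤n*m; m≤m*n;
         module ≤-Reasoning)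
open import Data.Nat.ListAction using (sum)
open import Data.Nat.ListAction.Properties using (sum-↭)
open import Data.Fin.Subset
  using (Subset; ⋃; ⋂; ∣_∣; Nonempty; Empty; ⊤; ⊥; _⊆_; _⊂_; _─_; _∩_; ∁; inside; outside; ⁅_⁆)
  renaming (_∈_ to _∈ₛ_; _∉_ to _∉ₛ_)
open import Data.Fin.Subset.Properties
  using (_∈?_; _⊆?_; nonempty?; ⊆-refl; ⊆-trans; ⊆-antisym; ⊆⊤; ∈⊤; ∉⊥; p─q⊆p; ∣p─q∣≤∣p∣;
         x∈p∧x∉q⇒x∈p─q; x∉p⇒x∈∁p; x∈p∩q⁺; x∈p∩q⁻; x∈p∪q⁻; ∪-identityʳ; p⊆q⇒∣p∣≤∣q∣; ∣⁅x⁆∣≡1;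
         x∈⁅y⁆⇒x≡y)
open import Data.Vec using (_∷_; here; there)
open import Data.List using (List; []; _∷_; map; zip; _++_; [_])
open import Data.List.Properties using (map-∘)
open import Data.List.Relation.Unary.All as All using (All; []; _∷_)
open import Data.List.Relation.Unary.All.Properties using (map⁺; map⁻; ¬Any⇒All¬)
open import Data.List.Relation.Unary.Any using (Any; here; there; any?)
import Data.List.Relation.Unary.Any.Properties as Any
open import Data.List.Relation.Unary.Unique.Propositional using (Unique)
open import Data.List.Relation.Unary.AllPairs using (_∷_)
open import Data.List.Membership.Propositional using (_∈_; find)
open import Data.List.Membership.Propositional.Properties using (∈-map⁺; ∈-map⁻; ∈-∃++)
open import Data.List.Relation.Binary.Permutation.Propositional using (_↭_; ↭-sym; ↭⇒↭ₛ)
open import Data.List.Relation.Binary.Permutation.Propositional.Properties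
  using (∈-resp-↭; shift; ↭-singleton-inv)
  renaming (map⁺ to ↭-map⁺)
import Data.List.Relation.Binary.Permutation.Setoid.Properties as Permutationₛ
open import Data.Product using (_×_; _,_; proj₁; proj₂; ∃)
open import Data.Sum using (_⊎_; inj₁; inj₂; [_,_]′)
open import Data.Empty using (⊥-elim)
open import Function using (_∘_; id)
open import Function.Bundles using (mk⇔; Equivalence)
open import Relation.Nullary using (¬_; yes; no)
open import Relation.Nullary.Decidable using (decidable-stable)
open import Relation.Binary.PropositionalEquality
  using (_≡_; _≢_; refl; sym; trans; cong; subst; subst₂; setoid; ≢-sym)

private variable
  n : ℕ
  p q r x : Subset n
  𝓑 : List (Subset n)

x∈p─q⇒x∉q : ∀ {i} → i ∈ₛ p ─ q → i ∉ₛ q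
x∈p─q⇒x∉q {p = inside ∷ p} {outside ∷ q} here ()
x∈p─q⇒x∉q {p = _ ∷ p} {_ ∷ q} (there i∈p─q) (there i∈q) = x∈p─q⇒x∉q i∈p─q i∈q

Empty[p─q]⇒p⊆q : Empty (p ─ q) → p ⊆ q
Empty[p─q]⇒p⊆q {q = q} p─q-empty {i} i∈p with i ∈? q
... | yes i∈q = i∈q
... | no  i∉q = ⊥-elim (p─q-empty (i , x∈p∧x∉q⇒x∈p─q i∈p i∉q))

p⊆r∧q─p⊆r⇒q⊆r : p ⊆ r → q ─ p ⊆ r → q ⊆ r
p⊆r∧q─p⊆r⇒q⊆r {p = p} p⊆r q─p⊆r {i} i∈q with i ∈? p
... | yes i∈p = p⊆r i∈p
... | no  i∉p = q─p⊆r (x∈p∧x∉q⇒x∈p─q i∈q i∉p)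

⊆⇒≡⊎⊂ : p ⊆ q → p ≡ q ⊎ p ⊂ q
⊆⇒≡⊎⊂ {p = p} {q} p⊆q with nonempty? (q ─ p)
... | yes (i , i∈q─p) = inj₂ (p⊆q , i , p─q⊆p q p i∈q─p , x∈p─q⇒x∉q i∈q─p)
... | no  q─p-empty   = inj₁ (⊆-antisym p⊆q (Empty[p─q]⇒p⊆q q─p-empty))

∁p⊆p⇒p≡⊤ : ∁ p ⊆ p → p ≡ ⊤
∁p⊆p⇒p≡⊤ {p = p} ∁p⊆p = ⊆-antisym ⊆⊤ λ {i} _ →
  decidable-stable (i ∈? p) (λ i∉p → i∉p (∁p⊆p (x∉p⇒x∈∁p i∉p)))

⋃-least : ∀ {ps : List (Subset n)} → All (_⊆ r) ps → ⋃ ps ⊆ r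
⋃-least []                             i∈⋃ = ⊥-elim (∉⊥ i∈⋃)
⋃-least {ps = p ∷ ps} (p⊆r ∷ ps⊆r) i∈⋃ = [ p⊆r , ⋃-least ps⊆r ]′ (x∈p∪q⁻ p (⋃ ps) i∈⋃)

Nonempty⇒0<∣p∣ : Nonempty p → 0 < ∣ p ∣
Nonempty⇒0<∣p∣ {p = p} (i , i∈p) = ≤-trans (≤-reflexive (sym (∣⁅x⁆∣≡1 i))) (p⊆q⇒∣p∣≤∣q∣ ⁅i⁆⊆p)
  where
  ⁅i⁆⊆p : ⁅ i ⁆ ⊆ p
  ⁅i⁆⊆p j∈⁅i⁆ = subst (_∈ₛ p) (sym (x∈⁅y⁆⇒x≡y i j∈⁅i⁆)) i∈p

∈⇒↭∷ : ∀ {A : Set} {a : A} {as : List A} → a ∈ as → ∃ λ bs → as ↭ a ∷ bs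
∈⇒↭∷ a∈as with ws , zs , refl ← ∈-∃++ a∈as = ws ++ zs , shift _ ws zs

sum-map-≤-*-sum-map :
  ∀ {A K : Set} (key : A → K) (f g : A → ℕ) (k : ℕ) {as bs : List A}
  → Unique (map key as)
  → (∀ {a} → a ∈ as → ∃ λ b → b ∈ bs × key b ≡ key a × f a ≤ k * g b)
  → sum (map f as) ≤ k * sum (map g bs)
sum-map-≤-*-sum-map key f g k {[]} _ _ = z≤n
sum-map-≤-*-sum-map key f g k {a ∷ as} {bs} (a-fresh ∷ uniq) match
  with b , b∈bs , keyb≡keya , fa≤ ← match (here refl)
  with bs′ , bs↭b∷bs′ ← ∈⇒↭∷ b∈bs = begin
    f a + sum (map f as)             ≤⟨ +-mono-≤ fa≤ (sum-map-≤-*-sum-map key f g k uniq match′) ⟩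
    k * g b + k * sum (map g bs′)    ≡⟨ *-distribˡ-+ k (g b) _ ⟨
    k * sum (map g (b ∷ bs′))        ≡⟨ cong (k *_) (sum-↭ (↭-map⁺ g (↭-sym bs↭b∷bs′))) ⟩
    k * sum (map g bs)               ∎
  where
  open ≤-Reasoning
  match′ : ∀ {a′} → a′ ∈ as → ∃ λ b′ → b′ ∈ bs′ × key b′ ≡ key a′ × f a′ ≤ k * g b′
  match′ a′∈as
    with b′ , b′∈bs , keyb′≡keya′ , fa′≤ ← match (there a′∈as)
    with ∈-resp-↭ bs↭b∷bs′ b′∈bs
  ... | there b′∈bs′ = b′ , b′∈bs′ , keyb′≡keya′ , fa′≤
  ... | here refl    = ⊥-elim (All.lookup a-fresh (∈-map⁺ key a′∈as)
                                 (trans (sym keyb≡keya) keyb′≡keya′))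

pathArcs : ∀ {A : Set} → A → List A → A → List (A × A)
pathArcs a as z = zip (a ∷ as) (as ++ [ z ])

module _ {A : Set} where

  ∈-pathArcs : ∀ {a z : A} {as e} → e ∈ pathArcs a as z → proj₁ e ∈ a ∷ as × proj₂ e ∈ z ∷ as
  ∈-pathArcs {as = []}     (here refl) = here refl , here refl
  ∈-pathArcs {as = b ∷ as} (here refl) = here refl , there (here refl)
  ∈-pathArcs {as = b ∷ as} (there e∈)  with t∈ , h∈ ← ∈-pathArcs e∈ = there t∈ , shift-head h∈
    where
    shift-head : ∀ {h z : A} → h ∈ z ∷ as → h ∈ z ∷ b ∷ as
    shift-head (here eq) = here eq
    shift-head (there h∈as) = there (there h∈as)

  ∈-cycleArcs : ∀ {as : List A} {e} → e ∈ cycleArcs as → proj₁ e ∈ as × proj₂ e ∈ as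
  ∈-cycleArcs {a ∷ as} = ∈-pathArcs

  pathArcs-irreflexive : ∀ {a z : A} {as} → Unique (a ∷ as) → All (_≢ z) (a ∷ as)
    → All (λ e → proj₁ e ≢ proj₂ e) (pathArcs a as z)
  pathArcs-irreflexive {as = []}     _                 (a≢z ∷ []) = a≢z ∷ []
  pathArcs-irreflexive {as = b ∷ as} ((a≢b ∷ _) ∷ uniq) (_ ∷ ≢z)  = a≢b ∷ pathArcs-irreflexive uniq ≢z

  cycleArcs-irreflexive : ∀ {as : List A} → Unique as → (∀ {a} → as ≢ [ a ])
    → All (λ e → proj₁ e ≢ proj₂ e) (cycleArcs as)
  cycleArcs-irreflexive {[]}         _ _ = []
  cycleArcs-irreflexive {a ∷ []}     _ not-singleton = ⊥-elim (not-singleton refl)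
  cycleArcs-irreflexive {a ∷ b ∷ as} ((a≢b ∷ a≢as) ∷ uniq′) _ =
    a≢b ∷ pathArcs-irreflexive uniq′ (All.map ≢-sym (a≢b ∷ a≢as))

  map-proj₁-pathArcs : ∀ (a : A) as z → map proj₁ (pathArcs a as z) ≡ a ∷ as
  map-proj₁-pathArcs a []       z = refl
  map-proj₁-pathArcs a (b ∷ as) z = cong (a ∷_) (map-proj₁-pathArcs b as z)

  map-proj₁-cycleArcs : ∀ (as : List A) → map proj₁ (cycleArcs as) ≡ as
  map-proj₁-cycleArcs []       = refl
  map-proj₁-cycleArcs (a ∷ as) = map-proj₁-pathArcs a as a

  module _ {ℓ} (P : A → Set ℓ) where

    Preserved : List (A × A) → Set ℓ
    Preserved = All (λ e → P (proj₁ e) → P (proj₂ e))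

    pathArcs-reach : ∀ {a z : A} {as w} → Preserved (pathArcs a as z) → w ∈ a ∷ as → P w → P z
    pathArcs-reach {as = []}     (h ∷ [])  (here refl) = h
    pathArcs-reach {as = b ∷ as} (h ∷ hs) (here refl) = pathArcs-reach hs (here refl) ∘ h
    pathArcs-reach {as = b ∷ as} (h ∷ hs) (there w∈)  = pathArcs-reach hs w∈

    pathArcs-spread : ∀ {a z : A} {as} → Preserved (pathArcs a as z) → P a → All P (a ∷ as)
    pathArcs-spread {as = []}     _        Pa = Pa ∷ []
    pathArcs-spread {as = b ∷ as} (h ∷ hs) Pa = Pa ∷ pathArcs-spread hs (h Pa)

    cycleArcs-spread : ∀ {as w} → Preserved (cycleArcs as) → w ∈ as → P w → All P as
    cycleArcs-spread {a ∷ as} preserved w∈ = pathArcs-spread preserved ∘ pathArcs-reach preserved w∈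

cost : Measure → Clause n → ℕ
cost mB  _       = 1
cost mBA (B , H) = ∣ B ∣
cost mTA (B , H) = ∣ B ∣ + ∣ H ∣
cost mC  (B , H) = ∣ H ∣
cost mBC (B , H) = ∣ H ∣ + 1
cost mL  (B , H) = (∣ B ∣ + 1) * ∣ H ∣

size≡sum-cost : ∀ m (Φ : CNF n) → size m Φ ≡ sum (map (cost m) Φ)
size≡sum-cost mB  _ = refl
size≡sum-cost mBA _ = refl
size≡sum-cost mTA _ = refl
size≡sum-cost mC  _ = refl
size≡sum-cost mBC _ = refl
size≡sum-cost mL  _ = refl

cost-≤-* : ∀ m (B H′ H : Subset n) k .{{_ : NonZero k}} .{{_ : NonZero ∣ H ∣}}
  → ∣ H′ ∣ ≤ k → cost m (B , H′) ≤ k * cost m (B , H)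
cost-≤-* mB  B H′ H k _   = m≤n*m 1 k
cost-≤-* mBA B H′ H k _   = m≤n*m ∣ B ∣ k
cost-≤-* mC  B H′ H k H′≤ = ≤-trans H′≤ (m≤m*n k ∣ H ∣)
cost-≤-* mTA B H′ H k H′≤ = begin
  ∣ B ∣ + ∣ H′ ∣           ≤⟨ +-mono-≤ (m≤n*m ∣ B ∣ k) (cost-≤-* mC B H′ H k H′≤) ⟩
  k * ∣ B ∣ + k * ∣ H ∣    ≡⟨ *-distribˡ-+ k ∣ B ∣ ∣ H ∣ ⟨
  k * (∣ B ∣ + ∣ H ∣)      ∎
  where open ≤-Reasoning
cost-≤-* mBC B H′ H k H′≤ = begin
  ∣ H′ ∣ + 1               ≤⟨ +-mono-≤ (cost-≤-* mC B H′ H k H′≤) (m≤n*m 1 k) ⟩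
  k * ∣ H ∣ + k * 1        ≡⟨ *-distribˡ-+ k ∣ H ∣ 1 ⟨
  k * (∣ H ∣ + 1)          ∎
  where open ≤-Reasoning
cost-≤-* mL  B H′ H k H′≤ = begin
  (∣ B ∣ + 1) * ∣ H′ ∣         ≤⟨ *-monoʳ-≤ (∣ B ∣ + 1) (cost-≤-* mC B H′ H k H′≤) ⟩
  (∣ B ∣ + 1) * (k * ∣ H ∣)   ≡⟨ *-assoc (∣ B ∣ + 1) k ∣ H ∣ ⟨
  (∣ B ∣ + 1) * k * ∣ H ∣     ≡⟨ cong (_* ∣ H ∣) (*-comm (∣ B ∣ + 1) k) ⟩
  k * (∣ B ∣ + 1) * ∣ H ∣     ≡⟨ *-assoc k (∣ B ∣ + 1) ∣ H ∣ ⟩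
  k * ((∣ B ∣ + 1) * ∣ H ∣)   ∎
  where open ≤-Reasoning

Sat-if-no-body⊆ : ∀ {Φ : CNF n} → ¬ Any (λ c → proj₁ c ⊆ x) Φ → Sat Φ x
Sat-if-no-body⊆ {Φ = Φ} none = All.map (λ body⊈x body⊆x → ⊥-elim (body⊈x body⊆x)) (¬Any⇒All¬ Φ none)

¬Sat⇒Any-body⊆ : ∀ {Φ : CNF n} → ¬ Sat Φ x → Any (λ c → proj₁ c ⊆ x) Φ
¬Sat⇒Any-body⊆ {x = x} {Φ} unsat =
  decidable-stable (any? (λ c → proj₁ c ⊆? x) Φ) (unsat ∘ Sat-if-no-body⊆)

Sat-keyCNF⁺ : (∀ {B} → B ∈ 𝓑 → B ⊆ x → ∁ B ⊆ x) → Sat (keyCNF 𝓑) x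
Sat-keyCNF⁺ closed = map⁺ (All.tabulate closed)

Sat-keyCNF⁻ : ∀ {B} → Sat (keyCNF 𝓑) x → B ∈ 𝓑 → B ⊆ x → ∁ B ⊆ x
Sat-keyCNF⁻ sat = All.lookup (map⁻ sat)

WellFormedClause⇒head⊈body : WellFormedClause (p , q) → ¬ q ⊆ p
WellFormedClause⇒head⊈body (_ , (i , i∈q) , disjoint) q⊆p = disjoint (i , x∈p∩q⁺ (q⊆p i∈q , i∈q))

Sperner-⊆⇒≡ : ∀ {B B′} → Sperner 𝓑 → B ∈ 𝓑 → B′ ∈ 𝓑 → B ⊆ B′ → B ≡ B′
Sperner-⊆⇒≡ sperner B∈ B′∈ B⊆B′ = [ id , ⊥-elim ∘ sperner B∈ B′∈ ]′ (⊆⇒≡⊎⊂ B⊆B′)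

body-contains-member : ∀ {Ψ D H} → IsRepresentation 𝓑 Ψ → (D , H) ∈ Ψ → ∃ λ B → B ∈ 𝓑 × B ⊆ D
body-contains-member {𝓑 = 𝓑} {D = D} ((wellFormed , _) , equiv) c∈Ψ = find some-member⊆D
  where
  some-member⊆D : Any (_⊆ D) 𝓑
  some-member⊆D = decidable-stable (any? (_⊆? D) 𝓑) λ none →
    WellFormedClause⇒head⊈body (All.lookup wellFormed c∈Ψ)
      (All.lookup (Equivalence.from (equiv D) (Sat-if-no-body⊆ (none ∘ Any.map⁻))) c∈Ψ ⊆-refl)

member-falsifies-keyCNF : ∀ {B} → B ∈ 𝓑 → B ≢ ⊤ → ¬ Sat (keyCNF 𝓑) B
member-falsifies-keyCNF B∈ B≢⊤ sat = B≢⊤ (∁p⊆p⇒p≡⊤ (Sat-keyCNF⁻ sat B∈ ⊆-refl))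

member-is-body : ∀ {Ψ B} → Sperner 𝓑 → All (_≢ ⊤) 𝓑 → IsRepresentation 𝓑 Ψ → B ∈ 𝓑
  → ∃ λ H → (B , H) ∈ Ψ
member-is-body {B = B} sperner ≢⊤ rep@(_ , equiv) B∈
  with (D , H) , c∈Ψ , D⊆B ← find (¬Sat⇒Any-body⊆
         (member-falsifies-keyCNF B∈ (All.lookup ≢⊤ B∈) ∘ Equivalence.to (equiv B)))
  with B′ , B′∈ , B′⊆D ← body-contains-member rep c∈Ψ
  with refl ← Sperner-⊆⇒≡ sperner B′∈ B∈ (⊆-trans B′⊆D D⊆B)
  with refl ← ⊆-antisym D⊆B B′⊆D = H , c∈Ψ

arcClause-WellFormed : ∀ {a b} → Sperner 𝓑 → Nonempty a → a ∈ 𝓑 → b ∈ 𝓑 → a ≢ b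
  → WellFormedClause (a , b ─ a)
arcClause-WellFormed {a = a} {b} sperner a-nonempty a∈ b∈ a≢b =
  a-nonempty , head-nonempty , disjoint
  where
  head-nonempty : Nonempty (b ─ a)
  head-nonempty = decidable-stable (nonempty? (b ─ a)) λ b─a-empty →
    a≢b (sym (Sperner-⊆⇒≡ sperner b∈ a∈ (Empty[p─q]⇒p⊆q b─a-empty)))
  disjoint : Empty (a ∩ (b ─ a))
  disjoint (i , i∈) with i∈a , i∈b─a ← x∈p∩q⁻ a (b ─ a) i∈ = x∈p─q⇒x∉q i∈b─a i∈a

Arcs : List (Subset n) → List (Subset n × Subset n) → Set
Arcs 𝓑 = All (λ e → proj₁ e ∈ 𝓑 × proj₂ e ∈ 𝓑)

arcCNF-IsPureHornCNF : ∀ {E} → Sperner 𝓑 → All Nonempty 𝓑 → Arcs 𝓑 E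
  → All (λ e → proj₁ e ≢ proj₂ e) E → Unique (map proj₁ E) → IsPureHornCNF (arcCNF E)
arcCNF-IsPureHornCNF {𝓑 = 𝓑} {E = E} sperner nonempty arcs irreflexive uniq =
  map⁺ (All.zipWith wellFormed (arcs , irreflexive)) , subst Unique (map-∘ E) uniq
  where
  wellFormed : ∀ {e} → (proj₁ e ∈ 𝓑 × proj₂ e ∈ 𝓑) × proj₁ e ≢ proj₂ e
    → WellFormedClause (proj₁ e , proj₂ e ─ proj₁ e)
  wellFormed ((a∈ , b∈) , a≢b) = arcClause-WellFormed sperner (All.lookup nonempty a∈) a∈ b∈ a≢b

keyCNF⇒arcCNF : ∀ {E} → Arcs 𝓑 E → Sat (keyCNF 𝓑) x → Sat (arcCNF E) x
keyCNF⇒arcCNF {𝓑 = 𝓑} {x = x} arcs sat = map⁺ (All.map fire arcs)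
  where
  fire : ∀ {e} → proj₁ e ∈ 𝓑 × proj₂ e ∈ 𝓑 → proj₁ e ⊆ x → proj₂ e ─ proj₁ e ⊆ x
  fire (a∈ , _) a⊆x i∈b─a = Sat-keyCNF⁻ sat a∈ a⊆x (x∉p⇒x∈∁p (x∈p─q⇒x∉q i∈b─a))

arcCNF-preserves-⊆ : ∀ {E} → Sat (arcCNF E) x → Preserved (_⊆ x) E
arcCNF-preserves-⊆ {x = x} sat = All.map step (map⁻ sat)
  where
  step : ∀ {a b} → (a ⊆ x → b ─ a ⊆ x) → a ⊆ x → b ⊆ x
  step fire a⊆x = p⊆r∧q─p⊆r⇒q⊆r a⊆x (fire a⊆x)

cycle-arcCNF⇒keyCNF : ∀ {cyc} → ⋃ 𝓑 ≡ ⊤ → (∀ {B} → B ∈ 𝓑 → B ∈ cyc)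
  → Sat (arcCNF (cycleArcs cyc)) x → Sat (keyCNF 𝓑) x
cycle-arcCNF⇒keyCNF {𝓑 = 𝓑} {x = x} covers 𝓑⊆cyc sat = Sat-keyCNF⁺ λ B∈ B⊆x {i} _ →
  ⋃-least (all-⊆ B∈ B⊆x) (subst (i ∈ₛ_) (sym covers) ∈⊤)
  where
  all-⊆ : ∀ {B} → B ∈ 𝓑 → B ⊆ x → All (_⊆ x) 𝓑
  all-⊆ B∈ B⊆x = All.tabulate λ B′∈ →
    All.lookup (cycleArcs-spread (_⊆ x) (arcCNF-preserves-⊆ sat) (𝓑⊆cyc B∈) B⊆x) (𝓑⊆cyc B′∈)

arcCNF-size-≤ : ∀ {k E} → Sperner 𝓑 → All (λ B → Nonempty B × B ≢ ⊤) 𝓑 → All (λ B → ∣ B ∣ ≤ k) 𝓑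
  → Arcs 𝓑 E → Unique (map proj₁ E)
  → ∀ m (Ψ : CNF n) → IsRepresentation 𝓑 Ψ → size m (arcCNF E) ≤ k * size m Ψ
arcCNF-size-≤ {𝓑 = 𝓑} {k = k} {E} sperner proper small arcs uniq m Ψ rep@((wellFormed , _) , _) =
  subst₂ (λ s t → s ≤ k * t) (sym (size≡sum-cost m _)) (sym (size≡sum-cost m Ψ))
    (sum-map-≤-*-sum-map proj₁ (cost m) (cost m) k (subst Unique (map-∘ E) uniq) match)
  where
  match : ∀ {c} → c ∈ arcCNF E → ∃ λ d → d ∈ Ψ × proj₁ d ≡ proj₁ c × cost m c ≤ k * cost m d
  match c∈
    with (a , b) , e∈ , refl ← ∈-map⁻ _ c∈
    with a∈ , b∈ ← All.lookup arcs e∈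
    with H , d∈Ψ ← member-is-body sperner (All.map proj₂ proper) rep a∈ =
    (a , H) , d∈Ψ , refl ,
    cost-≤-* m a (b ─ a) H k
      {{>-nonZero (≤-trans (Nonempty⇒0<∣p∣ (proj₁ (All.lookup proper a∈))) (All.lookup small a∈))}}
      {{>-nonZero (Nonempty⇒0<∣p∣ (proj₁ (proj₂ (All.lookup wellFormed d∈Ψ))))}}
      (≤-trans (∣p─q∣≤∣p∣ b a) (All.lookup small b∈))

-- Excludes the loop (B , B), whose clause would have an empty head.
covering-proper-family-not-singleton : ⋃ 𝓑 ≡ ⊤ → All (_≢ ⊤) 𝓑 → ∀ {B} → 𝓑 ≢ [ B ]
covering-proper-family-not-singleton covers (B≢⊤ ∷ []) refl = B≢⊤ (trans (sym (∪-identityʳ _)) covers)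

lemma4 : ∀ {n : ℕ} (𝓑 : List (Subset n)) (k : ℕ)
    → Unique 𝓑
    → Sperner 𝓑
    → All (λ B → Nonempty B × B ≢ ⊤) 𝓑
    → ⋃ 𝓑 ≡ ⊤
    → ⋂ 𝓑 ≡ ⊥
    → All (λ B → ∣ B ∣ ≤ k) 𝓑
    → (cyc : List (Subset n))
    → cyc ↭ 𝓑
    → IsRepresentation 𝓑 (arcCNF (cycleArcs cyc))
      × (∀ (m : Measure) (Ψ : CNF n) → IsRepresentation 𝓑 Ψ
           → size m (arcCNF (cycleArcs cyc)) ≤ k * size m Ψ)
lemma4 {n} 𝓑 k unique sperner proper covers _ small cyc cyc↭𝓑 =
  (arcCNF-IsPureHornCNF sperner (All.map proj₁ proper) arcs irreflexive tails-unique ,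
   λ x → mk⇔ (cycle-arcCNF⇒keyCNF covers (∈-resp-↭ (↭-sym cyc↭𝓑))) (keyCNF⇒arcCNF arcs)) ,
  arcCNF-size-≤ sperner proper small arcs tails-unique
  where
  cyc-unique : Unique cyc
  cyc-unique = Permutationₛ.Unique-resp-↭ (setoid (Subset n)) (↭⇒↭ₛ (↭-sym cyc↭𝓑)) unique
  tails-unique : Unique (map proj₁ (cycleArcs cyc))
  tails-unique = subst Unique (sym (map-proj₁-cycleArcs cyc)) cyc-unique
  arcs : Arcs 𝓑 (cycleArcs cyc)
  arcs = All.tabulate λ e∈ → let a∈ , b∈ = ∈-cycleArcs e∈ in ∈-resp-↭ cyc↭𝓑 a∈ , ∈-resp-↭ cyc↭𝓑 b∈
  irreflexive : All (λ e → proj₁ e ≢ proj₂ e) (cycleArcs cyc)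
  irreflexive = cycleArcs-irreflexive cyc-unique λ cyc≡[B] →
    covering-proper-family-not-singleton covers (All.map proj₂ proper)
      (↭-singleton-inv (↭-sym (subst (_↭ 𝓑) cyc≡[B] cyc↭𝓑)))
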